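{- Let $G=(V,E)$ be a connected finite simple graph with $n=|V|$, and let $\mathcal G$ be the graph constructed from $G$ as described in the context. If a stalled subset $\mathcal S$ of the vertex set of $\mathcal G$ contains $e^i$ and $e^{i+1}$ for some $e\in E$ and some $0\le i\le 2n-1$, then $\mathcal S$ contains all of $e^0,e^1,\dots,e^{2n}$.
   Context: For a finite simple graph $H$ with vertex set $W$ and a set $F\subseteq W$: a vertex $v\in W\setminus F$ is forced by $F$ if there is $u\in F$ such that $v$ is the unique neighbor of $u$ outside $F$. $F$ is stalled if no vertex of $W\setminus F$ is forced by $F$. Construction of $\mathcal G$: given $G=(V,E)$ with $n=|V|$, let $E^i=\{e^i : e\in E\}$ for $i=0,1,\dots,2n$ be $2n+1$ pairwise disjoint copies of $E$ (disjoint from $V$), and let $\varepsilon$ be a further new vertex. The vertex set of $\mathcal G$ is $\mathcal V=V\cup E^0\cup\dots\cup E^{2n}\cup\{\varepsilon\}$. The edges of $\mathcal G$ are exactly: for every edge $e=\{u,v\}\in E$, the edges $\{u,e^0\}$ and $\{e^0,v\}$; the edges $\{e^i,e^{i+1}\}$ for $0\le i\le 2n-1$; and the edge $\{\varepsilon,e^0\}$. -}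

module Defs where

open import Data.Nat using (ℕ; suc; _*_)
open import Data.Fin using (Fin; zero; suc; inject₁; _<_)
open import Data.Bool using (Bool; true; false; T)
open import Data.Product using (Σ; _×_; _,_; proj₁; proj₂; ∃)
open import Data.Sum using (_⊎_)
open import Data.Empty using (⊥)
open import Relation.Nullary using (¬_)
open import Relation.Binary.PropositionalEquality using (_≡_)

record SimpleGraph (n : ℕ) : Set where
  field
    adj   : Fin n → Fin n → Bool
    sym   : ∀ u v → adj u v ≡ adj v u
    irrefl : ∀ u → adj u u ≡ false
open SimpleGraph public

data Walk {n : ℕ} (G : SimpleGraph n) : Fin n → Fin n → Set where
  here : ∀ {u} → Walk G u u
  step : ∀ {u v w} → T (adj G u v) → Walk G v w → Walk G u w

Connected : {n : ℕ} → SimpleGraph n → Set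
Connected G = ∀ u v → Walk G u v

-- Edge set E: each edge {u,v} represented uniquely as (u , v) with u < v.
Edge : {n : ℕ} → SimpleGraph n → Set
Edge {n} G = Σ (Fin n × Fin n) λ p → (proj₁ p < proj₂ p) × T (adj G (proj₁ p) (proj₂ p))

-- Vertex set of the constructed graph 𝒢:
-- V ∪ E^0 ∪ … ∪ E^{2n} ∪ {ε}; copy e^i is  cpy e i  with i : Fin (2n+1).
data CV {n : ℕ} (G : SimpleGraph n) : Set where
  vtx : Fin n → CV G
  cpy : Edge G → Fin (suc (2 * n)) → CV G
  eps : CV G

data CAdj₀ {n : ℕ} (G : SimpleGraph n) : CV G → CV G → Set where
  end₁  : (e : Edge G) → CAdj₀ G (vtx (proj₁ (proj₁ e))) (cpy e zero)
  end₂  : (e : Edge G) → CAdj₀ G (vtx (proj₂ (proj₁ e))) (cpy e zero)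
  chain : (e : Edge G) (i : Fin (2 * n)) → CAdj₀ G (cpy e (inject₁ i)) (cpy e (suc i))
  top   : (e : Edge G) → CAdj₀ G eps (cpy e zero)

CAdj : {n : ℕ} (G : SimpleGraph n) → CV G → CV G → Set
CAdj G x y = CAdj₀ G x y ⊎ CAdj₀ G y x

Forced : {W : Set} (A : W → W → Set) (F : W → Bool) → W → Set
Forced {W} A F v = (F v ≡ false) × ∃ λ u → (F u ≡ true) × A u v ×
                     (∀ w → A u w → F w ≡ false → w ≡ v)

Stalled : {W : Set} (A : W → W → Set) (F : W → Bool) → Set
Stalled {W} A F = ∀ v → ¬ Forced A F v

-- The copies e⁰, e¹, …, e²ⁿ form a path in 𝒢 whose interior vertices e¹, …, e²ⁿ⁻¹
-- have no other neighbours. A stalled set containing a degree-two vertex and one of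
-- its neighbours must contain the other neighbour, since otherwise that neighbour is
-- forced. So two consecutive copies in 𝒮 drag the next copy in on either side, and
-- the membership spreads along the whole path.
module Submission where

open import Defs hiding (sym)
open import Data.Nat using (ℕ; _*_; zero; suc; _+_; _∸_; _≤_; _<_; s≤s; _≤?_)
open import Data.Nat.Properties
  using (suc-injective; +-suc; ≤-trans; n≤1+n; m≤n+m; ≤-pred; <-trans; n<1+n; ≰⇒>; m∸n+n≡m)
open import Data.Fin using (Fin; suc; inject₁; toℕ; fromℕ<)
open import Data.Fin.Properties using (toℕ-injective; toℕ-inject₁; toℕ-fromℕ<; toℕ<n)
open import Data.Bool using (Bool; true; false)
open import Data.Product using (_×_; _,_; proj₁; proj₂)
open import Data.Sum using (_⊎_; inj₁; inj₂; swap)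
open import Data.Empty using (⊥-elim)
open import Relation.Nullary using (yes; no)
open import Function using (_∘_)
open import Relation.Binary.PropositionalEquality
  using (_≡_; refl; sym; trans; cong; subst)

stalled-degree-two : {W : Set} {A : W → W → Set} {F : W → Bool} → Stalled A F →
                     ∀ {u x y} → F u ≡ true → F x ≡ true → A u y →
                     (∀ w → A u w → w ≡ x ⊎ w ≡ y) → F y ≡ true
stalled-degree-two {A = A} {F = F} stalled {u} {x} {y} Fu Fx uy neighbours with F y in Fy
... | true  = refl
... | false = ⊥-elim (stalled y (Fy , u , Fu , uy , unique))
  where
  unique : ∀ w → A u w → F w ≡ false → w ≡ y
  unique w uw Fw with neighbours w uw
  ... | inj₂ w≡y = w≡y
  ... | inj₁ refl with trans (sym Fw) Fx
  ...   | ()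

module Propagation {P : ℕ → Set} {N : ℕ}
  (extend-up   : ∀ {m} → suc m < N → P m → P (suc m) → P (suc (suc m)))
  (extend-down : ∀ {m} → suc m < N → P (suc m) → P (suc (suc m)) → P m)
  where

  upward : ∀ d {k j} → d + suc k ≡ j → j ≤ N → P k → P (suc k) → P j
  upward zero    refl _   _  Psk = Psk
  upward (suc d) {k} refl j≤N Pk Psk =
    upward d (+-suc d (suc k)) j≤N Psk (extend-up (≤-trans (s≤s (m≤n+m (suc k) d)) j≤N) Pk Psk)

  downward : ∀ d {j k} → d + j ≡ k → k < N → P k → P (suc k) → P j
  downward zero    refl _   Pk _   = Pk
  downward (suc d) refl k<N Pk Psk =
    downward d refl (≤-trans (n≤1+n _) k<N) (extend-down k<N Pk Psk) Pk

  propagate : ∀ {k} → k < N → P k → P (suc k) → ∀ {j} → j ≤ N → P j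
  propagate {k} k<N Pk Psk {j} j≤N with j ≤? k
  ... | yes j≤k = downward (k ∸ j) (m∸n+n≡m j≤k) k<N Pk Psk
  ... | no  j≰k = upward (j ∸ suc k) (m∸n+n≡m (≰⇒> j≰k)) j≤N Pk Psk

module CopyPath {n : ℕ} (G : SimpleGraph n) (e : Edge G) where

  copy : Fin (suc (2 * n)) → CV G
  copy = cpy e

  copy-cong : ∀ {a b} → toℕ a ≡ toℕ b → copy a ≡ copy b
  copy-cong eq = cong copy (toℕ-injective eq)

  copies-adjacent : ∀ {m a b} → toℕ a ≡ m → toℕ b ≡ suc m → CAdj₀ G (copy a) (copy b)
  copies-adjacent {b = suc i} a≡ refl =
    subst (λ x → CAdj₀ G x (copy (suc i))) (copy-cong (trans (toℕ-inject₁ i) (sym a≡))) (chain e i)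

  interior-neighbours : ∀ {m a b c} → toℕ a ≡ m → toℕ b ≡ suc m → toℕ c ≡ suc (suc m) →
                        ∀ w → CAdj G (copy b) w → w ≡ copy a ⊎ w ≡ copy c
  interior-neighbours a≡ b≡ c≡ _ (inj₁ (chain _ i)) =
    inj₂ (copy-cong (trans (cong suc (trans (sym (toℕ-inject₁ i)) b≡)) (sym c≡)))
  interior-neighbours a≡ b≡ c≡ _ (inj₂ (chain _ i)) =
    inj₁ (copy-cong (trans (toℕ-inject₁ i) (trans (suc-injective b≡) (sym a≡))))
  interior-neighbours a≡ () c≡ _ (inj₂ (end₁ _))
  interior-neighbours a≡ () c≡ _ (inj₂ (end₂ _))
  interior-neighbours a≡ () c≡ _ (inj₂ (top _))

  module Membership (S : CV G → Bool) where

    InS : ℕ → Set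
    InS m = ∀ a → toℕ a ≡ m → S (copy a) ≡ true

    InS-of : ∀ {m a} → toℕ a ≡ m → S (copy a) ≡ true → InS m
    InS-of a≡ Sa b b≡ = subst (λ x → S x ≡ true) (copy-cong (trans a≡ (sym b≡))) Sa

    interior-step : Stalled (CAdj G) S → ∀ {m} → suc m < 2 * n → InS (suc m) →
                    (InS m → InS (suc (suc m))) × (InS (suc (suc m)) → InS m)
    interior-step stalled {m} sm<N Psm =
      (λ Pm → InS-of c≡ (force (Pm a a≡) (inj₁ (copies-adjacent b≡ c≡)) neighbours)) ,
      (λ Pssm → InS-of a≡ (force (Pssm c c≡) (inj₂ (copies-adjacent a≡ b≡)) (λ w → swap ∘ neighbours w)))
      where
      c<N+1 : suc (suc m) < suc (2 * n)
      c<N+1 = s≤s sm<N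
      b<N+1 : suc m < suc (2 * n)
      b<N+1 = <-trans (n<1+n (suc m)) c<N+1
      a<N+1 : m < suc (2 * n)
      a<N+1 = <-trans (n<1+n m) b<N+1
      a b c : Fin (suc (2 * n))
      a = fromℕ< a<N+1
      b = fromℕ< b<N+1
      c = fromℕ< c<N+1
      a≡ : toℕ a ≡ m
      a≡ = toℕ-fromℕ< a<N+1
      b≡ : toℕ b ≡ suc m
      b≡ = toℕ-fromℕ< b<N+1
      c≡ : toℕ c ≡ suc (suc m)
      c≡ = toℕ-fromℕ< c<N+1
      neighbours : ∀ w → CAdj G (copy b) w → w ≡ copy a ⊎ w ≡ copy c
      neighbours = interior-neighbours a≡ b≡ c≡
      force : ∀ {x y} → S x ≡ true → CAdj G (copy b) y →
              (∀ w → CAdj G (copy b) w → w ≡ x ⊎ w ≡ y) → S y ≡ true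
      force = stalled-degree-two stalled (Psm b b≡)

mainTheorem4 : {n : ℕ} (G : SimpleGraph n) → Connected G →
               (S : CV G → Bool) → Stalled (CAdj G) S →
               (e : Edge G) (i : Fin (2 * n)) →
               S (cpy e (inject₁ i)) ≡ true → S (cpy e (suc i)) ≡ true →
               ∀ j → S (cpy e j) ≡ true
mainTheorem4 G _ S stalled e i Si Ssi j =
  propagate (toℕ<n i) (InS-of (toℕ-inject₁ i) Si) (InS-of refl Ssi) (≤-pred (toℕ<n j)) j refl
  where
  open CopyPath G e
  open Membership S
  open Propagation (λ lt Pm Psm → proj₁ (interior-step stalled lt Psm) Pm)
                   (λ lt Psm Pssm → proj₂ (interior-step stalled lt Psm) Pssm)
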